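{- Minimal power term polynomials are not canonical with respect to Boolean polynomials: there exists a Boolean polynomial $p$ (in variables $x_1,\dots,x_n$) admitting two minimal power term polynomials $\pi$ and $\rho$ representing $p$ (i.e. $[\![\pi]\!]=[\![\rho]\!]=p$) that are distinct, in the sense that the collections of atomic terms occurring in $\pi$ and in $\rho$ differ (so $\pi$ and $\rho$ are not equal even modulo commutativity and associativity of $\uplus$).
   Context: Let $\mathcal{D}=\{x_1,\dots,x_n\}$ be a set of Boolean variables. Boolean polynomials are elements of $\mathbb{F}_2[x_1,\dots,x_n]/(x_i^2-x_i : i\in[n])$. For $W\subseteq\mathcal{D}$ write $m_W=\prod_{x\in W}x$ (with $m_\emptyset=1$). For $U\subseteq\mathcal{D}$ the modified power set is $\mathbf{P}_U=\{\emptyset\}$ if $U=\emptyset$ and $\mathbf{P}_U=\{T\subseteq U: T\neq\emptyset\}$ otherwise. A (well-formed) power term is a pair written $S.\mathbf{P}_U$ with $S,U\subseteq\mathcal{D}$ such that $S\cap U=\emptyset$, $|U|\neq 1$, and $(S,U)\neq(\emptyset,\emptyset)$; it denotes the family $\{S\cup T: T\in\mathbf{P}_U\}$ and its semantics is the Boolean polynomial $[\![S.\mathbf{P}_U]\!]=\sum_{T\in\mathbf{P}_U} m_{S\cup T}$. There are also two constants $S_\emptyset.\mathbf{P}_\emptyset$ and $S_I.\mathbf{P}_\emptyset$ with semantics $0$ and $1$. A power term polynomial is a formal expression built from power terms and the two constants by a binary operator $\uplus$, which is commutative and associative, has $S_\emptyset.\mathbf{P}_\emptyset$ as identity and satisfies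 $\pi\uplus\pi=S_\emptyset.\mathbf{P}_\emptyset$; its semantics is $[\![\pi\uplus\rho]\!]=[\![\pi]\!]+[\![\rho]\!]$ (addition over $\mathbb{F}_2$). A power term polynomial $\pi$ represents $p$ if $[\![\pi]\!]=p$. The size $\mathrm{Size}(\pi)$ is the number of atomic terms (power terms or constants) occurring in $\pi$; $\pi$ representing $p$ is minimal if $\mathrm{Size}(\pi)\le\mathrm{Size}(\rho)$ for every power term polynomial $\rho$ representing $p$. -}

module Defs where

open import Data.Bool using (Bool; true; false; _xor_; if_then_else_)
import Data.Bool as B
open import Data.Nat using (ℕ; zero; suc; _+_; _≤_)
open import Data.List using (List; []; _∷_; _++_; map; filterᵇ; foldr; [_])
open import Data.List.Relation.Unary.All using (All)
open import Data.Unit using (⊤)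
open import Data.Vec using (Vec; []; _∷_)
open import Data.Vec.Properties using (≡-dec)
open import Data.Fin.Subset using (Subset; inside; outside; ⊥; _∩_; _∪_; _⊆_; ∣_∣)
open import Data.Fin.Subset.Properties using (_⊆?_)
open import Data.Product using (_×_; Σ)
open import Relation.Nullary using (¬_; Dec; yes; no; does)
open import Relation.Nullary.Decidable using (⌊_⌋)
open import Relation.Binary.PropositionalEquality using (_≡_; _≢_)

_≟ₛ_ : ∀ {n} (A B : Subset n) → Dec (A ≡ B)
_≟ₛ_ = ≡-dec B._≟_

allSubsets : (n : ℕ) → List (Subset n)
allSubsets zero    = [ [] ]
allSubsets (suc n) = map (outside ∷_) (allSubsets n) ++ map (inside ∷_) (allSubsets n)

-- A Boolean polynomial in F_2[x_1..x_n]/(x_i^2 - x_i) is given by its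
-- coefficients w.r.t. the monomial basis m_W (W ⊆ {x_1..x_n}).
BoolPoly : ℕ → Set
BoolPoly n = Subset n → Bool

_≈ₚ_ : ∀ {n} → BoolPoly n → BoolPoly n → Set
p ≈ₚ q = ∀ W → p W ≡ q W

0ₚ : ∀ {n} → BoolPoly n
0ₚ _ = false

_+ₚ_ : ∀ {n} → BoolPoly n → BoolPoly n → BoolPoly n
(p +ₚ q) W = p W xor q W

mono : ∀ {n} → Subset n → BoolPoly n
mono W V = ⌊ W ≟ₛ V ⌋

sumₚ : ∀ {n} → List (BoolPoly n) → BoolPoly n
sumₚ = foldr _+ₚ_ 0ₚ

inP : ∀ {n} → Subset n → Subset n → Bool
inP U T with U ≟ₛ ⊥
... | yes _ = ⌊ T ≟ₛ ⊥ ⌋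
... | no  _ = ⌊ T ⊆? U ⌋ B.∧ B.not ⌊ T ≟ₛ ⊥ ⌋

Pset : ∀ {n} → Subset n → List (Subset n)
Pset {n} U = filterᵇ (inP U) (allSubsets n)

data Atom (n : ℕ) : Set where
  S∅P∅ : Atom n
  SIP∅ : Atom n
  _·P_ : Subset n → Subset n → Atom n

WFAtom : ∀ {n} → Atom n → Set
WFAtom S∅P∅ = ⊤
WFAtom SIP∅ = ⊤
WFAtom (S ·P U) = (S ∩ U ≡ ⊥) × (∣ U ∣ ≢ 1) × ¬ ((S ≡ ⊥) × (U ≡ ⊥))

⟦_⟧ᵃ : ∀ {n} → Atom n → BoolPoly n
⟦ S∅P∅ ⟧ᵃ = 0ₚ
⟦ SIP∅ ⟧ᵃ = mono ⊥
⟦ S ·P U ⟧ᵃ = sumₚ (map (λ T → mono (S ∪ T)) (Pset U))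

infixl 6 _⊎_
data PTP (n : ℕ) : Set where
  atom : Atom n → PTP n
  _⊎_  : PTP n → PTP n → PTP n

atoms : ∀ {n} → PTP n → List (Atom n)
atoms (atom a) = [ a ]
atoms (π ⊎ ρ) = atoms π ++ atoms ρ

WF : ∀ {n} → PTP n → Set
WF π = All WFAtom (atoms π)

⟦_⟧ : ∀ {n} → PTP n → BoolPoly n
⟦ atom a ⟧ = ⟦ a ⟧ᵃ
⟦ π ⊎ ρ ⟧ = ⟦ π ⟧ +ₚ ⟦ ρ ⟧

Size : ∀ {n} → PTP n → ℕ
Size (atom _) = 1
Size (π ⊎ ρ) = Size π + Size ρ

Represents : ∀ {n} → PTP n → BoolPoly n → Set
Represents π p = WF π × (⟦ π ⟧ ≈ₚ p)

Minimal : ∀ {n} → PTP n → BoolPoly n → Set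
Minimal π p = Represents π p × (∀ ρ → Represents ρ p → Size π ≤ Size ρ)

-- Take p = x₁ + x₂. It is represented both by {x₁}.P∅ ⊎ {x₂}.P∅ and by
-- {x₁,x₂}.P∅ ⊎ ∅.P{x₁,x₂}, since ⟦∅.P{x₁,x₂}⟧ = x₁ + x₂ + x₁x₂. No single
-- atom has semantics p (a Boolean polynomial in two variables is determined by
-- its four coefficients, so this is a finite check), hence both representations
-- of size 2 are minimal, and {x₁}.P∅ does not occur in the second one.
module Submission where

open import Defs
open import Data.Nat using (ℕ; suc; _≤_; s≤s; z≤n)
open import Data.Empty using (⊥-elim)
open import Data.Nat.Properties using (≤-trans; m≤m+n; +-mono-≤)
open import Data.Bool using (Bool; true; false)
open import Data.Vec using ([]; _∷_)
open import Data.Fin.Subset using (Subset; inside; outside; ⊥)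
open import Data.Product using (Σ; _×_; _,_)
open import Data.List using (List; []; _∷_; map)
open import Data.List.Properties using (map-cong; ∷-injectiveˡ; ∷-injectiveʳ)
open import Data.List.Relation.Unary.All using ([]; _∷_)
open import Data.List.Relation.Unary.Any using (here; there)
open import Data.List.Membership.Propositional using (_∈_; _∉_)
open import Data.List.Membership.Propositional.Properties using (∈-map⁺; ∈-++⁺ˡ; ∈-++⁺ʳ)
open import Data.List.Relation.Binary.Permutation.Propositional using (_↭_)
open import Data.List.Relation.Binary.Permutation.Propositional.Properties using (∈-resp-↭)
open import Relation.Nullary using (¬_)
open import Relation.Binary.PropositionalEquality using (_≡_; _≢_; refl)

∈-allSubsets : ∀ {n} (W : Subset n) → W ∈ allSubsets n
∈-allSubsets []             = here refl
∈-allSubsets (outside ∷ W) = ∈-++⁺ˡ (∈-map⁺ (outside ∷_) (∈-allSubsets W))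
∈-allSubsets {suc n} (inside ∷ W) =
  ∈-++⁺ʳ (map (outside ∷_) (allSubsets n)) (∈-map⁺ (inside ∷_) (∈-allSubsets W))

coefficients : ∀ {n} → BoolPoly n → List Bool
coefficients {n} p = map p (allSubsets n)

≈ₚ⇒coefficients≡ : ∀ {n} {p q : BoolPoly n} → p ≈ₚ q → coefficients p ≡ coefficients q
≈ₚ⇒coefficients≡ {n} p≈q = map-cong p≈q (allSubsets n)

coefficients≡⇒≈ₚ : ∀ {n} {p q : BoolPoly n} → coefficients p ≡ coefficients q → p ≈ₚ q
coefficients≡⇒≈ₚ {p = p} {q} eq W = agreeOn (∈-allSubsets W) eq
  where
  agreeOn : ∀ {Ws : List (Subset _)} → W ∈ Ws → map p Ws ≡ map q Ws → p W ≡ q W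
  agreeOn (here refl) eq = ∷-injectiveˡ eq
  agreeOn (there W∈) eq  = agreeOn W∈ (∷-injectiveʳ eq)

Size-positive : ∀ {n} (π : PTP n) → 1 ≤ Size π
Size-positive (atom _) = s≤s z≤n
Size-positive (π ⊎ ρ)  = ≤-trans (Size-positive π) (m≤m+n (Size π) (Size ρ))

Size≥2-of-non-atomic : ∀ {n} {p : BoolPoly n} → (∀ a → ¬ (⟦ a ⟧ᵃ ≈ₚ p)) →
                       ∀ π → Represents π p → 2 ≤ Size π
Size≥2-of-non-atomic notAtomic (atom a) (_ , a≈p) = ⊥-elim (notAtomic a a≈p)
Size≥2-of-non-atomic notAtomic (π ⊎ ρ) _ = +-mono-≤ (Size-positive π) (Size-positive ρ)

x₁ x₂ x₁x₂ : Subset 2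
x₁   = inside ∷ outside ∷ []
x₂   = outside ∷ inside ∷ []
x₁x₂ = inside ∷ inside ∷ []

p : BoolPoly 2
p = mono x₁ +ₚ mono x₂

π ρ : PTP 2
π = atom (x₁ ·P ⊥) ⊎ atom (x₂ ·P ⊥)
ρ = atom (x₁x₂ ·P ⊥) ⊎ atom (⊥ ·P x₁x₂)

p-not-atomic : ∀ a → ¬ (⟦ a ⟧ᵃ ≈ₚ p)
p-not-atomic a a≈p = coefficients-differ a (≈ₚ⇒coefficients≡ a≈p)
  where
  coefficients-differ : ∀ a → coefficients ⟦ a ⟧ᵃ ≢ coefficients p
  coefficients-differ S∅P∅ ()
  coefficients-differ SIP∅ ()
  coefficients-differ ((false ∷ false ∷ []) ·P (false ∷ false ∷ [])) ()
  coefficients-differ ((false ∷ false ∷ []) ·P (false ∷ true  ∷ [])) ()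
  coefficients-differ ((false ∷ false ∷ []) ·P (true  ∷ false ∷ [])) ()
  coefficients-differ ((false ∷ false ∷ []) ·P (true  ∷ true  ∷ [])) ()
  coefficients-differ ((false ∷ true  ∷ []) ·P (false ∷ false ∷ [])) ()
  coefficients-differ ((false ∷ true  ∷ []) ·P (false ∷ true  ∷ [])) ()
  coefficients-differ ((false ∷ true  ∷ []) ·P (true  ∷ false ∷ [])) ()
  coefficients-differ ((false ∷ true  ∷ []) ·P (true  ∷ true  ∷ [])) ()
  coefficients-differ ((true  ∷ false ∷ []) ·P (false ∷ false ∷ [])) ()
  coefficients-differ ((true  ∷ false ∷ []) ·P (false ∷ true  ∷ [])) ()
  coefficients-differ ((true  ∷ false ∷ []) ·P (true  ∷ false ∷ [])) ()
  coefficients-differ ((true  ∷ false ∷ []) ·P (true  ∷ true  ∷ [])) ()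
  coefficients-differ ((true  ∷ true  ∷ []) ·P (false ∷ false ∷ [])) ()
  coefficients-differ ((true  ∷ true  ∷ []) ·P (false ∷ true  ∷ [])) ()
  coefficients-differ ((true  ∷ true  ∷ []) ·P (true  ∷ false ∷ [])) ()
  coefficients-differ ((true  ∷ true  ∷ []) ·P (true  ∷ true  ∷ [])) ()

π-represents-p : Represents π p
π-represents-p = wf , coefficients≡⇒≈ₚ refl
  where
  wf : WF π
  wf = (refl , (λ ()) , λ { (() , _) }) ∷ (refl , (λ ()) , λ { (() , _) }) ∷ []

ρ-represents-p : Represents ρ p
ρ-represents-p = wf , coefficients≡⇒≈ₚ refl
  where
  wf : WF ρ
  wf = (refl , (λ ()) , λ { (() , _) }) ∷ (refl , (λ ()) , λ { (_ , ()) }) ∷ []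

x₁·P⊥∉ρ : x₁ ·P ⊥ ∉ atoms ρ
x₁·P⊥∉ρ (here ())
x₁·P⊥∉ρ (there (here ()))
x₁·P⊥∉ρ (there (there ()))

mainTheorem1 : Σ ℕ λ n → Σ (BoolPoly n) λ p → Σ (PTP n) λ π → Σ (PTP n) λ ρ →
    Minimal π p × Minimal ρ p × ¬ (atoms π ↭ atoms ρ)
mainTheorem1 =
  2 , p , π , ρ ,
  (π-represents-p , Size≥2-of-non-atomic p-not-atomic) ,
  (ρ-represents-p , Size≥2-of-non-atomic p-not-atomic) ,
  λ π↭ρ → x₁·P⊥∉ρ (∈-resp-↭ π↭ρ (here refl))
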